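{- Let $\Lambda=\Lambda(b,\mathcal{F})$ be a BLPR problem, $x$ a basic solution of $\Lambda$, and $G(x)=G(L,R,E)$ its supporting graph. Then $|E|\le M^*+2k^*-1$.
   Context: Given a positive integer $k$, positive integers $m_1,\dots,m_k$, non-negative integers $t_1,\dots,t_M$ with $M\le\sum_i m_i$, a real vector $b=(b_1,\dots,b_k)$ and a set $\mathcal{F}\subseteq\{1,\dots,k\}\times\{1,\dots,M\}$, the BLPR problem $\Lambda(b,\mathcal{F})$ is the feasibility problem in real variables $x_{ij}$ ($1\le i\le k$, $1\le j\le M$): $\sum_j x_{ij}t_j\le b_i$ and $\sum_j x_{ij}\le m_i$ for all $i$; $\sum_i x_{ij}=1$ for all $j$; $x_{ij}=1$ for $(i,j)\in\mathcal{F}$; $x_{ij}\ge0$. A basic solution is a feasible solution that is the unique solution of a set of linearly independent constraints holding with equality. Let $c_i=|\{j:(i,j)\in\mathcal{F}\}|$. A job $j$ is free if $(i,j)\notin\mathcal{F}$ for all $i$; a machine $i$ is free if $c_i<m_i$. $M^*$, $k^*$ are the numbers of free jobs and free machines. The supporting graph $G(x)=G(L,R,E)$ of a feasible solution $x$ is the bipartite graph with $L$ the set of free machines, $R$ the set of free jobs, and edge set $E=\{(i,j): i\in L,\ j\in R,\ x_{ij}>0,\ (i,j)\notin\mathcal{F}\}$. -}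

module Defs where

open import Level using (Level; _⊔_) renaming (suc to lsuc)
open import Data.Nat as ℕ using (ℕ; zero; suc; _<ᵇ_)
open import Data.Bool using (Bool; true; false; not; _∨_; if_then_else_)
open import Data.Fin using (Fin; _≟_) renaming (zero to fzero; suc to fsuc)
open import Data.Product using (Σ; ∃; _×_; _,_)
open import Data.Unit using (⊤)
open import Data.List using (List; length; lookup)
open import Data.List.Relation.Unary.All using (All)
open import Relation.Nullary using (¬_; does)
open import Relation.Binary.Core using (Rel)
open import Relation.Binary.Structures using (IsTotalOrder)
open import Relation.Binary.PropositionalEquality using (_≡_)
open import Algebra.Bundles using (CommutativeRing; Semiring)
import Algebra.Definitions.RawSemiring as RS

countB : ∀ {n} → (Fin n → Bool) → ℕ
countB {zero}  p = 0
countB {suc n} p = (if p fzero then 1 else 0) ℕ.+ countB (λ i → p (fsuc i))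

anyB : ∀ {n} → (Fin n → Bool) → Bool
anyB {zero}  p = false
anyB {suc n} p = p fzero ∨ anyB (λ i → p (fsuc i))

sumℕ : ∀ {n} → (Fin n → ℕ) → ℕ
sumℕ {zero}  f = 0
sumℕ {suc n} f = f fzero ℕ.+ sumℕ (λ i → f (fsuc i))

record OrderedField c ℓ₁ ℓ₂ : Set (lsuc (c ⊔ ℓ₁ ⊔ ℓ₂)) where
  field
    commutativeRing : CommutativeRing c ℓ₁
  open CommutativeRing commutativeRing public
  field
    _≤_          : Rel Carrier ℓ₂
    isTotalOrder : IsTotalOrder _≈_ _≤_
    +-mono-≤     : ∀ {x y} z → x ≤ y → (x + z) ≤ (y + z)
    *-nonneg     : ∀ {x y} → 0# ≤ x → 0# ≤ y → 0# ≤ (x * y)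
    0≉1          : ¬ (0# ≈ 1#)
    inverse      : ∀ x → ¬ (x ≈ 0#) → ∃ λ y → (x * y) ≈ 1#

  _<_ : Carrier → Carrier → Set (ℓ₁ ⊔ ℓ₂)
  x < y = (x ≤ y) × ¬ (x ≈ y)

-- Constraints of a BLPR problem with k machines and M jobs.
--   cap i     :  Σ_j x_ij t_j ≤ b_i
--   card i    :  Σ_j x_ij ≤ m_i
--   assign j  :  Σ_i x_ij = 1
--   fix i j   :  x_ij = 1         (only admissible when (i,j) ∈ 𝓕)
--   nonneg i j:  x_ij ≥ 0

data Constraint (k M : ℕ) : Set where
  cap    : Fin k → Constraint k M
  card   : Fin k → Constraint k M
  assign : Fin M → Constraint k M
  fix    : Fin k → Fin M → Constraint k M
  nonneg : Fin k → Fin M → Constraint k M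

Admissible : ∀ {k M} → (Fin k → Fin M → Bool) → Constraint k M → Set
Admissible 𝓕 (fix i j) = 𝓕 i j ≡ true
Admissible 𝓕 _         = ⊤

module BLPR {c ℓ₁ ℓ₂} (𝔽 : OrderedField c ℓ₁ ℓ₂) where
  open OrderedField 𝔽
  open RS (Semiring.rawSemiring semiring) using (sum) renaming (_×_ to _·ℕ_)

  ⟦_⟧ : ℕ → Carrier
  ⟦ n ⟧ = n ·ℕ 1#

  Sol : ℕ → ℕ → Set c
  Sol k M = Fin k → Fin M → Carrier

  Feasible : ∀ {k M} (m : Fin k → ℕ) (t : Fin M → ℕ) (b : Fin k → Carrier)
             (𝓕 : Fin k → Fin M → Bool) → Sol k M → Set (ℓ₁ ⊔ ℓ₂)
  Feasible m t b 𝓕 x =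
      (∀ i → sum (λ j → x i j * ⟦ t j ⟧) ≤ b i)
    × (∀ i → sum (λ j → x i j) ≤ ⟦ m i ⟧)
    × (∀ j → sum (λ i → x i j) ≈ 1#)
    × (∀ i j → 𝓕 i j ≡ true → x i j ≈ 1#)
    × (∀ i j → 0# ≤ x i j)

  δ : ∀ {n} → Fin n → Fin n → Carrier
  δ a a' = if does (a ≟ a') then 1# else 0#

  coef : ∀ {k M} (t : Fin M → ℕ) → Constraint k M → Fin k → Fin M → Carrier
  coef t (cap i)      i' j' = δ i i' * ⟦ t j' ⟧
  coef t (card i)     i' j' = δ i i'
  coef t (assign j)   i' j' = δ j j'
  coef t (fix i j)    i' j' = δ i i' * δ j j'
  coef t (nonneg i j) i' j' = δ i i' * δ j j'

  rhs : ∀ {k M} (m : Fin k → ℕ) (b : Fin k → Carrier) → Constraint k M → Carrier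
  rhs m b (cap i)      = b i
  rhs m b (card i)     = ⟦ m i ⟧
  rhs m b (assign j)   = 1#
  rhs m b (fix i j)    = 1#
  rhs m b (nonneg i j) = 0#

  Tight : ∀ {k M} (m : Fin k → ℕ) (t : Fin M → ℕ) (b : Fin k → Carrier) →
          Sol k M → Constraint k M → Set ℓ₁
  Tight m t b x C = sum (λ i → sum (λ j → coef t C i j * x i j)) ≈ rhs m b C

  LinIndep : ∀ {k M} (t : Fin M → ℕ) → List (Constraint k M) → Set (c ⊔ ℓ₁)
  LinIndep t S = ∀ (λs : Fin (length S) → Carrier) →
    (∀ i j → sum (λ s → λs s * coef t (lookup S s) i j) ≈ 0#) →
    ∀ s → λs s ≈ 0#

  Basic : ∀ {k M} (m : Fin k → ℕ) (t : Fin M → ℕ) (b : Fin k → Carrier)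
          (𝓕 : Fin k → Fin M → Bool) → Sol k M → Set (c ⊔ ℓ₁ ⊔ ℓ₂)
  Basic m t b 𝓕 x =
    Feasible m t b 𝓕 x ×
    Σ (List (Constraint _ _)) λ S →
        All (Admissible 𝓕) S
      × LinIndep t S
      × All (Tight m t b x) S
      × (∀ (y : Sol _ _) → All (Tight m t b y) S → ∀ i j → y i j ≈ x i j)

  cnt : ∀ {k M} → (Fin k → Fin M → Bool) → Fin k → ℕ
  cnt 𝓕 i = countB (𝓕 i)

  freeMachine : ∀ {k M} (m : Fin k → ℕ) → (Fin k → Fin M → Bool) → Fin k → Bool
  freeMachine m 𝓕 i = cnt 𝓕 i <ᵇ m i

  freeJob : ∀ {k M} → (Fin k → Fin M → Bool) → Fin M → Bool
  freeJob 𝓕 j = not (anyB (λ i → 𝓕 i j))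

  kStar : ∀ {k M} (m : Fin k → ℕ) → (Fin k → Fin M → Bool) → ℕ
  kStar m 𝓕 = countB (freeMachine m 𝓕)

  MStar : ∀ {k M} → (Fin k → Fin M → Bool) → ℕ
  MStar 𝓕 = countB (freeJob 𝓕)

  Edge : ∀ {k M} (m : Fin k → ℕ) (𝓕 : Fin k → Fin M → Bool) → Sol k M →
         Fin k × Fin M → Set (ℓ₁ ⊔ ℓ₂)
  Edge m 𝓕 x (i , j) =
      (freeMachine m 𝓕 i ≡ true)
    × (freeJob 𝓕 j ≡ true)
    × (0# < x i j)
    × (𝓕 i j ≡ false)

-- Suppose the supporting graph had more than M* + 2k* − 1 edges, and consider perturbations d of x
-- supported on the edges.  Every constraint tight at x constrains d only through the capacity rows of
-- the free machines, the cardinality rows of the free machines other than one machine i₀ carrying an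
-- edge, and the assignment rows of the free jobs: the remaining rows do not see the edges (non-free
-- machines and jobs, fixed pairs, zero entries of x), except the cardinality row of i₀, which follows
-- from the others since the cardinality rows and the assignment rows both sum to Σ d.  These are
-- M* + 2k* − 1 linear forms in |E| unknowns, so some d ≠ 0 annihilates them, and x + d is a second
-- solution of the tight constraints defining x.
module Submission where

open import Defs
open import Data.Nat as ℕ using (ℕ; zero; suc; s≤s)
import Data.Nat.Properties as ℕₚ
open import Data.Nat.Tactic.RingSolver using (solve-∀)
open import Data.Fin using (Fin; punchIn; _≟_) renaming (zero to fzero; suc to fsuc)
open import Data.Fin.Properties using (punchInᵢ≢i)
open import Data.Bool using (Bool; true; false; not; _∧_)
open import Data.Bool.Properties using (not-¬)
open import Data.Empty using (⊥-elim)
open import Data.Product using (∃; _,_; proj₁; proj₂; _×_)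
open import Function using (_∘_)
open import Level using (_⊔_)
open import Relation.Nullary using (¬_; yes; no; does)
import Relation.Binary.PropositionalEquality as ≡
open ≡ using (_≡_; _≢_)
open import Data.List as List using (List; []; _∷_; length; _++_)
import Data.List.Properties as List
open import Data.List.Relation.Unary.All as All using (All; []; _∷_)
import Data.List.Relation.Unary.All.Properties as All
open import Data.List.Relation.Unary.Any using (here; there)
open import Data.List.Membership.Propositional using (_∈_)
open import Data.List.Membership.Propositional.Properties using (∈-map⁺; ∈-++⁺ˡ; ∈-++⁺ʳ; ∈-lookup)
open import Data.List.Relation.Unary.Unique.Propositional using (Unique)
open import Data.List.Relation.Unary.AllPairs using (_∷_)
open import Data.Vec.Functional using (insertAt)
open import Data.Vec.Functional.Properties using (insertAt-lookup; insertAt-punchIn)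
import Algebra.Properties.Semiring.Sum as SemiringSum
import Algebra.Properties.Ring as RingProperties

trues : ∀ {n} → (Fin n → Bool) → List (Fin n)
trues {zero}  p = []
trues {suc n} p with p fzero
... | true  = fzero ∷ List.map fsuc (trues (p ∘ fsuc))
... | false = List.map fsuc (trues (p ∘ fsuc))

length-trues : ∀ {n} (p : Fin n → Bool) → length (trues p) ≡ countB p
length-trues {zero}  p = ≡.refl
length-trues {suc n} p with p fzero
... | true  = ≡.cong suc (≡.trans (List.length-map fsuc (trues (p ∘ fsuc))) (length-trues (p ∘ fsuc)))
... | false = ≡.trans (List.length-map fsuc (trues (p ∘ fsuc))) (length-trues (p ∘ fsuc))

∈-trues : ∀ {n} (p : Fin n → Bool) {i} → p i ≡ true → i ∈ trues p
∈-trues {suc n} p {fzero}  p0≡true rewrite p0≡true = here ≡.refl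
∈-trues {suc n} p {fsuc i} pi≡true with p fzero
... | true  = there (∈-map⁺ fsuc (∈-trues (p ∘ fsuc) pi≡true))
... | false = ∈-map⁺ fsuc (∈-trues (p ∘ fsuc) pi≡true)

countB-cong : ∀ {n} {p q : Fin n → Bool} → (∀ i → p i ≡ q i) → countB p ≡ countB q
countB-cong {zero}  eq = ≡.refl
countB-cong {suc n} eq rewrite eq fzero = ≡.cong (_ ℕ.+_) (countB-cong (eq ∘ fsuc))

countB-remove : ∀ {n} (p : Fin n → Bool) {i} → p i ≡ true →
                countB p ≡ suc (countB (λ j → p j ∧ not (does (j ≟ i))))
countB-remove {suc n} p {fzero} pi≡true rewrite pi≡true =
  ≡.cong suc (countB-cong λ j → ≡.sym (∧-true (p (fsuc j))))
  where
  ∧-true : ∀ b → b ∧ true ≡ b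
  ∧-true true  = ≡.refl
  ∧-true false = ≡.refl
countB-remove {suc n} p {fsuc i} pi≡true with p fzero
... | true  = ≡.cong suc (countB-remove (p ∘ fsuc) pi≡true)
... | false = countB-remove (p ∘ fsuc) pi≡true

lookup-injective : ∀ {A : Set} {xs : List A} → Unique xs →
                   ∀ p q → List.lookup xs p ≡ List.lookup xs q → p ≡ q
lookup-injective (_ ∷ _)       fzero    fzero    _  = ≡.refl
lookup-injective (x∉xs ∷ _)    fzero    (fsuc q) eq = ⊥-elim (All.lookup x∉xs (∈-lookup q) eq)
lookup-injective (x∉xs ∷ _)    (fsuc p) fzero    eq = ⊥-elim (All.lookup x∉xs (∈-lookup p) (≡.sym eq))
lookup-injective (_ ∷ unique)  (fsuc p) (fsuc q) eq = ≡.cong fsuc (lookup-injective unique p q eq)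

module LinearAlgebra {c ℓ₁ ℓ₂} (𝔽 : OrderedField c ℓ₁ ℓ₂) where
  open OrderedField 𝔽
  open SemiringSum semiring public
    using (sum; sum-remove; ∑-distrib-+; ∑-comm; sum-cong-≋; *-distribˡ-sum; *-distribʳ-sum)
  open SemiringSum semiring using (sum-replicate-zero)
  open RingProperties ring using (-‿distribˡ-*; -‿distribʳ-*)
  open import Relation.Binary.Reasoning.Setoid setoid

  sum-zero : ∀ {n} (f : Fin n → Carrier) → (∀ i → f i ≈ 0#) → sum f ≈ 0#
  sum-zero {n} f f≈0 = trans (sum-cong-≋ f≈0) (sum-replicate-zero n)

  sum-single : ∀ {n} (f : Fin n → Carrier) a → (∀ i → i ≢ a → f i ≈ 0#) → sum f ≈ f a
  sum-single {suc n} f a off = begin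
    sum f                                   ≈⟨ sum-remove {i = a} f ⟩
    f a + sum (λ q → f (punchIn a q))       ≈⟨ +-congˡ (sum-zero _ (λ q → off _ (punchInᵢ≢i a q))) ⟩
    f a + 0#                                ≈⟨ +-identityʳ _ ⟩
    f a                                     ∎

  x+y≈x⇒y≈0 : ∀ x y → x + y ≈ x → y ≈ 0#
  x+y≈x⇒y≈0 x y x+y≈x = begin
    y              ≈⟨ sym (+-identityˡ y) ⟩
    0# + y         ≈⟨ +-congʳ (sym (-‿inverseˡ x)) ⟩
    (- x + x) + y  ≈⟨ +-assoc _ _ _ ⟩
    - x + (x + y)  ≈⟨ +-congˡ x+y≈x ⟩
    - x + x        ≈⟨ -‿inverseˡ x ⟩
    0#             ∎

  ⟨_,_⟩ : ∀ {n} → (Fin n → Carrier) → (Fin n → Carrier) → Carrier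
  ⟨ f , d ⟩ = sum (λ p → f p * d p)

  ⟨0,_⟩ : ∀ {n} {f : Fin n → Carrier} d → (∀ p → f p ≈ 0#) → ⟨ f , d ⟩ ≈ 0#
  ⟨0, d ⟩ f≈0 = sum-zero _ (λ p → trans (*-congʳ (f≈0 p)) (zeroˡ (d p)))

  Annihilates : ∀ {n} → List (Fin n → Carrier) → (Fin n → Carrier) → Set (c ⊔ ℓ₁)
  Annihilates L d = All (λ f → ⟨ f , d ⟩ ≈ 0#) L

  TrivialKernel : ∀ {n} → List (Fin n → Carrier) → Set (c ⊔ ℓ₁)
  TrivialKernel L = ∀ d → Annihilates L d → ∀ p → d p ≈ 0#

  -- Equality in the field is not decidable, so a pivot is only found under double negation.
  ¬∀≈0⇒¬¬nonzero : ∀ {n} (f : Fin n → Carrier) → ¬ (∀ p → f p ≈ 0#) → ¬ ¬ ∃ λ p → ¬ f p ≈ 0#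
  ¬∀≈0⇒¬¬nonzero {zero}  f f≉0 _        = f≉0 (λ ())
  ¬∀≈0⇒¬¬nonzero {suc n} f f≉0 ¬nonzero = ¬nonzero (fzero , λ f0≈0 →
    ¬∀≈0⇒¬¬nonzero (f ∘ fsuc)
      (λ f∘fsuc≈0 → f≉0 λ { fzero → f0≈0 ; (fsuc p) → f∘fsuc≈0 p })
      (λ { (p , fp≉0) → ¬nonzero (fsuc p , fp≉0) }))

  trivialKernel-∷⁻ : ∀ {n} {f : Fin n → Carrier} {L} → (∀ p → f p ≈ 0#) →
                     TrivialKernel (f ∷ L) → TrivialKernel L
  trivialKernel-∷⁻ f≈0 trivial d ann = trivial d (⟨0, d ⟩ f≈0 ∷ ann)

  -- Gaussian elimination of the variable p using the pivot f p.
  module Elimination {n} (f : Fin (suc n) → Carrier) (p : Fin (suc n)) (fp≉0 : ¬ f p ≈ 0#) where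
    u : Carrier
    u = proj₁ (inverse (f p) fp≉0)

    fp*u≈1 : f p * u ≈ 1#
    fp*u≈1 = proj₂ (inverse (f p) fp≉0)

    eliminate : (Fin (suc n) → Carrier) → Fin n → Carrier
    eliminate g q = g (punchIn p q) + (- (g p * u)) * f (punchIn p q)

    restrict : (Fin (suc n) → Carrier) → Fin n → Carrier
    restrict g = g ∘ punchIn p

    extend : (Fin n → Carrier) → Fin (suc n) → Carrier
    extend d' = insertAt d' p (- (u * ⟨ restrict f , d' ⟩))

    ⟨,extend⟩-split : ∀ g d' → ⟨ g , extend d' ⟩ ≈ g p * - (u * ⟨ restrict f , d' ⟩) + ⟨ restrict g , d' ⟩
    ⟨,extend⟩-split g d' = begin
      ⟨ g , extend d' ⟩                                          ≈⟨ sum-remove {i = p} (λ i → g i * extend d' i) ⟩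
      g p * extend d' p + sum (λ q → restrict g q * extend d' (punchIn p q))
        ≈⟨ +-cong (*-congˡ (reflexive (insertAt-lookup d' p _)))
                  (sum-cong-≋ (λ q → *-congˡ (reflexive (insertAt-punchIn d' p _ q)))) ⟩
      g p * - (u * ⟨ restrict f , d' ⟩) + ⟨ restrict g , d' ⟩   ∎

    ⟨f,extend⟩≈0 : ∀ d' → ⟨ f , extend d' ⟩ ≈ 0#
    ⟨f,extend⟩≈0 d' = begin
      ⟨ f , extend d' ⟩             ≈⟨ ⟨,extend⟩-split f d' ⟩
      f p * - (u * S) + S           ≈⟨ +-congʳ (sym (-‿distribʳ-* _ _)) ⟩
      - (f p * (u * S)) + S         ≈⟨ +-congʳ (-‿cong (sym (*-assoc _ _ _))) ⟩
      - ((f p * u) * S) + S         ≈⟨ +-congʳ (-‿cong (*-congʳ fp*u≈1)) ⟩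
      - (1# * S) + S                ≈⟨ +-congʳ (-‿cong (*-identityˡ S)) ⟩
      - S + S                       ≈⟨ -‿inverseˡ S ⟩
      0#                            ∎
      where
      S : Carrier
      S = ⟨ restrict f , d' ⟩

    ⟨eliminate,⟩≈⟨,extend⟩ : ∀ g d' → ⟨ eliminate g , d' ⟩ ≈ ⟨ g , extend d' ⟩
    ⟨eliminate,⟩≈⟨,extend⟩ g d' = begin
      ⟨ eliminate g , d' ⟩
        ≈⟨ sum-cong-≋ (λ q → distribʳ (d' q) _ _) ⟩
      sum (λ q → restrict g q * d' q + (a * restrict f q) * d' q)
        ≈⟨ ∑-distrib-+ (λ q → restrict g q * d' q) _ ⟩
      ⟨ restrict g , d' ⟩ + sum (λ q → (a * restrict f q) * d' q)
        ≈⟨ +-congˡ (sum-cong-≋ (λ q → *-assoc a (restrict f q) (d' q))) ⟩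
      ⟨ restrict g , d' ⟩ + sum (λ q → a * (restrict f q * d' q))
        ≈⟨ +-congˡ (sym (*-distribˡ-sum a (λ q → restrict f q * d' q))) ⟩
      ⟨ restrict g , d' ⟩ + a * S                 ≈⟨ +-comm _ _ ⟩
      a * S + ⟨ restrict g , d' ⟩                 ≈⟨ +-congʳ (sym (-‿distribˡ-* _ _)) ⟩
      - ((g p * u) * S) + ⟨ restrict g , d' ⟩     ≈⟨ +-congʳ (-‿cong (*-assoc _ _ _)) ⟩
      - (g p * (u * S)) + ⟨ restrict g , d' ⟩     ≈⟨ +-congʳ (-‿distribʳ-* _ _) ⟩
      g p * - (u * S) + ⟨ restrict g , d' ⟩       ≈⟨ sym (⟨,extend⟩-split g d') ⟩
      ⟨ g , extend d' ⟩                           ∎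
      where
      a : Carrier
      a = - (g p * u)
      S : Carrier
      S = ⟨ restrict f , d' ⟩

    trivialKernel-eliminate : ∀ {L} → TrivialKernel (f ∷ L) → TrivialKernel (List.map eliminate L)
    trivialKernel-eliminate {L} trivial d' ann q = begin
      d' q                       ≡⟨ ≡.sym (insertAt-punchIn d' p _ q) ⟩
      extend d' (punchIn p q)    ≈⟨ trivial (extend d') (⟨f,extend⟩≈0 d' ∷ ann-extend) (punchIn p q) ⟩
      0#                         ∎
      where
      ann-extend : Annihilates L (extend d')
      ann-extend = All.map (λ {g} ⟨eg,d'⟩≈0 → trans (sym (⟨eliminate,⟩≈⟨,extend⟩ g d')) ⟨eg,d'⟩≈0)
                           (All.map⁻ ann)

  -- induction on the number r of forms; elimination removes one variable and one form
  length<⇒¬trivialKernel : ∀ {n} (L : List (Fin n → Carrier)) → length L ℕ.< n → ¬ TrivialKernel L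
  length<⇒¬trivialKernel L = go (length L) L ≡.refl
    where
    go : ∀ r {n} (L : List (Fin n → Carrier)) → length L ≡ r → length L ℕ.< n → ¬ TrivialKernel L
    go _       {suc n} []      _   _           trivial = 0≉1 (sym (trivial (λ _ → 1#) [] fzero))
    go (suc r) {suc n} (f ∷ L) len (s≤s |L|<n) trivial =
      ¬∀≈0⇒¬¬nonzero f
        (λ f≈0 → go r L (ℕₚ.suc-injective len) (ℕₚ.m<n⇒m<1+n |L|<n) (trivialKernel-∷⁻ f≈0 trivial))
        (λ { (p , fp≉0) → let open Elimination f p fp≉0 in
             go r (List.map eliminate L)
               (≡.trans (List.length-map eliminate L) (ℕₚ.suc-injective len))
               (≡.subst (ℕ._< n) (≡.sym (List.length-map eliminate L)) |L|<n)
               (trivialKernel-eliminate trivial) })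

module KroneckerDelta {c ℓ₁ ℓ₂} (𝔽 : OrderedField c ℓ₁ ℓ₂) where
  open OrderedField 𝔽
  open BLPR 𝔽 using (δ)
  open LinearAlgebra 𝔽
  open import Relation.Binary.Reasoning.Setoid setoid

  δ-refl : ∀ {n} (a : Fin n) → δ a a ≈ 1#
  δ-refl a with a ≟ a
  ... | yes _  = refl
  ... | no a≢a = ⊥-elim (a≢a ≡.refl)

  δ-≢ : ∀ {n} {a b : Fin n} → a ≢ b → δ a b ≈ 0#
  δ-≢ {a = a} {b} a≢b with a ≟ b
  ... | yes a≡b = ⊥-elim (a≢b a≡b)
  ... | no _    = refl

  δ-sym : ∀ {n} (a b : Fin n) → δ a b ≈ δ b a
  δ-sym a b with a ≟ b | b ≟ a
  ... | yes _   | yes _   = refl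
  ... | no _    | no _    = refl
  ... | yes a≡b | no b≢a  = ⊥-elim (b≢a (≡.sym a≡b))
  ... | no a≢b  | yes b≡a = ⊥-elim (a≢b (≡.sym b≡a))

  sum-δ : ∀ {n} (a : Fin n) (g : Fin n → Carrier) → sum (λ i → δ a i * g i) ≈ g a
  sum-δ a g = begin
    sum (λ i → δ a i * g i)
      ≈⟨ sum-single _ a (λ i i≢a → trans (*-congʳ (δ-≢ (i≢a ∘ ≡.sym))) (zeroˡ (g i))) ⟩
    δ a a * g a              ≈⟨ *-congʳ (δ-refl a) ⟩
    1# * g a                 ≈⟨ *-identityˡ (g a) ⟩
    g a                      ∎

  sum-δ′ : ∀ {n} (a : Fin n) (w : Carrier) → sum (λ i → δ i a * w) ≈ w
  sum-δ′ a w = trans (sum-cong-≋ (λ i → *-congʳ (δ-sym i a))) (sum-δ a (λ _ → w))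

  sum-δδ : ∀ {k M} (a : Fin k) (b : Fin M) (g : Fin k → Fin M → Carrier) →
           sum (λ i → sum (λ j → (δ a i * δ b j) * g i j)) ≈ g a b
  sum-δδ a b g = begin
    sum (λ i → sum (λ j → (δ a i * δ b j) * g i j))
      ≈⟨ sum-cong-≋ (λ i → sum-cong-≋ (λ j → *-assoc (δ a i) (δ b j) (g i j))) ⟩
    sum (λ i → sum (λ j → δ a i * (δ b j * g i j)))
      ≈⟨ sum-cong-≋ (λ i → sym (*-distribˡ-sum (δ a i) (λ j → δ b j * g i j))) ⟩
    sum (λ i → δ a i * sum (λ j → δ b j * g i j))
      ≈⟨ sum-cong-≋ (λ i → *-congˡ (sum-δ b (g i))) ⟩
    sum (λ i → δ a i * g i b)
      ≈⟨ sum-δ a (λ i → g i b) ⟩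
    g a b                                            ∎

  δδ-≢ : ∀ {k M} {i i′ : Fin k} {j j′ : Fin M} → (i , j) ≢ (i′ , j′) → δ i i′ * δ j j′ ≈ 0#
  δδ-≢ {i = i} {i′} {j} {j′} ij≢i′j′ with i ≟ i′ | j ≟ j′
  ... | no _    | _       = zeroˡ _
  ... | yes _   | no _    = zeroʳ _
  ... | yes i≡i′ | yes j≡j′ = ⊥-elim (ij≢i′j′ (≡.cong₂ _,_ i≡i′ j≡j′))

module Perturbation {c ℓ₁ ℓ₂} (𝔽 : OrderedField c ℓ₁ ℓ₂)
                    {k M n} (t : Fin M → ℕ) (e : Fin n → Fin k × Fin M) where
  open OrderedField 𝔽
  open BLPR 𝔽
  open LinearAlgebra 𝔽
  open KroneckerDelta 𝔽
  open import Relation.Binary.Reasoning.Setoid setoid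

  machine : Fin n → Fin k
  machine p = proj₁ (e p)

  job : Fin n → Fin M
  job p = proj₂ (e p)

  lhs : Constraint k M → Sol k M → Carrier
  lhs C y = sum (λ i → sum (λ j → coef t C i j * y i j))

  row : Constraint k M → Fin n → Carrier
  row C p = coef t C (machine p) (job p)

  spread : (Fin n → Carrier) → Sol k M
  spread d i j = sum (λ p → (δ (machine p) i * δ (job p) j) * d p)

  _+ˢ_ : Sol k M → Sol k M → Sol k M
  (y +ˢ z) i j = y i j + z i j

  lhs-+ˢ : ∀ C y z → lhs C (y +ˢ z) ≈ lhs C y + lhs C z
  lhs-+ˢ C y z = begin
    sum (λ i → sum (λ j → coef t C i j * (y i j + z i j)))
      ≈⟨ sum-cong-≋ (λ i → sum-cong-≋ (λ j → distribˡ (coef t C i j) (y i j) (z i j))) ⟩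
    sum (λ i → sum (λ j → coef t C i j * y i j + coef t C i j * z i j))
      ≈⟨ sum-cong-≋ (λ i → ∑-distrib-+ (λ j → coef t C i j * y i j) (λ j → coef t C i j * z i j)) ⟩
    sum (λ i → sum (λ j → coef t C i j * y i j) + sum (λ j → coef t C i j * z i j))
      ≈⟨ ∑-distrib-+ (λ i → sum (λ j → coef t C i j * y i j)) (λ i → sum (λ j → coef t C i j * z i j)) ⟩
    lhs C y + lhs C z ∎

  lhs-spread : ∀ C d → lhs C (spread d) ≈ ⟨ row C , d ⟩
  lhs-spread C d = begin
    sum (λ i → sum (λ j → coef t C i j * sum (λ p → Δ p i j * d p)))
      ≈⟨ sum-cong-≋ (λ i → sum-cong-≋ (λ j → *-distribˡ-sum (coef t C i j) (λ p → Δ p i j * d p))) ⟩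
    sum (λ i → sum (λ j → sum (λ p → coef t C i j * (Δ p i j * d p))))
      ≈⟨ sum-cong-≋ (λ i → ∑-comm (λ j p → coef t C i j * (Δ p i j * d p))) ⟩
    sum (λ i → sum (λ p → sum (λ j → coef t C i j * (Δ p i j * d p))))
      ≈⟨ ∑-comm (λ i p → sum (λ j → coef t C i j * (Δ p i j * d p))) ⟩
    sum (λ p → sum (λ i → sum (λ j → coef t C i j * (Δ p i j * d p))))
      ≈⟨ sum-cong-≋ at-edge ⟩
    ⟨ row C , d ⟩ ∎
    where
    Δ : Fin n → Fin k → Fin M → Carrier
    Δ p i j = δ (machine p) i * δ (job p) j

    at-edge : ∀ p → sum (λ i → sum (λ j → coef t C i j * (Δ p i j * d p))) ≈ row C p * d p
    at-edge p = begin
      sum (λ i → sum (λ j → coef t C i j * (Δ p i j * d p)))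
        ≈⟨ sum-cong-≋ (λ i → sum-cong-≋ (λ j → rearrange (coef t C i j) (Δ p i j) (d p))) ⟩
      sum (λ i → sum (λ j → (Δ p i j * coef t C i j) * d p))
        ≈⟨ sum-cong-≋ (λ i → sym (*-distribʳ-sum (d p) (λ j → Δ p i j * coef t C i j))) ⟩
      sum (λ i → sum (λ j → Δ p i j * coef t C i j) * d p)
        ≈⟨ sym (*-distribʳ-sum (d p) (λ i → sum (λ j → Δ p i j * coef t C i j))) ⟩
      sum (λ i → sum (λ j → Δ p i j * coef t C i j)) * d p
        ≈⟨ *-congʳ (sum-δδ (machine p) (job p) (coef t C)) ⟩
      row C p * d p ∎
      where
      rearrange : ∀ u v w → u * (v * w) ≈ (v * u) * w
      rearrange u v w = trans (sym (*-assoc u v w)) (*-congʳ (*-comm u v))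

  sum-row-card : ∀ d → sum (λ i → ⟨ row (card i) , d ⟩) ≈ sum d
  sum-row-card d = trans (∑-comm (λ i p → δ i (machine p) * d p)) (sum-cong-≋ (λ p → sum-δ′ (machine p) (d p)))

  sum-row-assign : ∀ d → sum (λ j → ⟨ row (assign j) , d ⟩) ≈ sum d
  sum-row-assign d = trans (∑-comm (λ j p → δ j (job p) * d p)) (sum-cong-≋ (λ p → sum-δ′ (job p) (d p)))

  tight-+spread : ∀ {m b x C} d → Tight m t b x C → ⟨ row C , d ⟩ ≈ 0# → Tight m t b (x +ˢ spread d) C
  tight-+spread {m} {b} {x} {C} d tight ⟨row,d⟩≈0 = begin
    lhs C (x +ˢ spread d)        ≈⟨ lhs-+ˢ C x (spread d) ⟩
    lhs C x + lhs C (spread d)   ≈⟨ +-cong tight (trans (lhs-spread C d) ⟨row,d⟩≈0) ⟩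
    rhs m b C + 0#               ≈⟨ +-identityʳ _ ⟩
    rhs m b C                    ∎

  spread-at : (∀ p q → e p ≡ e q → p ≡ q) → ∀ d p → spread d (machine p) (job p) ≈ d p
  spread-at e-injective d p = begin
    spread d (machine p) (job p)                           ≈⟨ sum-single _ p off-diagonal ⟩
    (δ (machine p) (machine p) * δ (job p) (job p)) * d p  ≈⟨ *-congʳ (*-cong (δ-refl (machine p)) (δ-refl (job p))) ⟩
    (1# * 1#) * d p                                        ≈⟨ *-congʳ (*-identityˡ 1#) ⟩
    1# * d p                                               ≈⟨ *-identityˡ (d p) ⟩
    d p                                                    ∎
    where
    off-diagonal : ∀ q → q ≢ p → (δ (machine q) (machine p) * δ (job q) (job p)) * d q ≈ 0#
    off-diagonal q q≢p = trans (*-congʳ (δδ-≢ (q≢p ∘ e-injective q p))) (zeroˡ (d q))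

module ReducedSystem {c ℓ₁ ℓ₂} (𝔽 : OrderedField c ℓ₁ ℓ₂)
                     {k M} (m : Fin k → ℕ) (𝓕 : Fin k → Fin M → Bool) where
  open BLPR 𝔽 using (freeMachine; freeJob; kStar; MStar)
  open import Data.Nat using (_+_; _*_; _∸_)
  open ≡.≡-Reasoning

  freeMachineExcept : Fin k → Fin k → Bool
  freeMachineExcept i₀ i = freeMachine m 𝓕 i ∧ not (does (i ≟ i₀))

  capRows : List (Constraint k M)
  capRows = List.map cap (trues (freeMachine m 𝓕))

  cardRowsExcept : Fin k → List (Constraint k M)
  cardRowsExcept i₀ = List.map card (trues (freeMachineExcept i₀))

  assignRows : List (Constraint k M)
  assignRows = List.map assign (trues (freeJob 𝓕))

  reduced : Fin k → List (Constraint k M)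
  reduced i₀ = capRows ++ cardRowsExcept i₀ ++ assignRows

  length-reduced : ∀ {i₀} → freeMachine m 𝓕 i₀ ≡ true →
                   length (reduced i₀) ≡ MStar 𝓕 + 2 * kStar m 𝓕 ∸ 1
  length-reduced {i₀} i₀-free = begin
    length (capRows ++ cardRowsExcept i₀ ++ assignRows)
      ≡⟨ List.length-++ capRows ⟩
    length capRows + length (cardRowsExcept i₀ ++ assignRows)
      ≡⟨ ≡.cong (length capRows +_) (List.length-++ (cardRowsExcept i₀)) ⟩
    length capRows + (length (cardRowsExcept i₀) + length assignRows)
      ≡⟨ ≡.cong₂ _+_ (length-map-trues cap (freeMachine m 𝓕))
                     (≡.cong₂ _+_ (length-map-trues card (freeMachineExcept i₀))
                                  (length-map-trues assign (freeJob 𝓕))) ⟩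
    countB (freeMachine m 𝓕) + (K + J)
      ≡⟨ ≡.cong (_+ (K + J)) (countB-remove (freeMachine m 𝓕) i₀-free) ⟩
    suc K + (K + J)
      ≡⟨ ≡.cong (_∸ 1) (≡.sym (count-identity K J)) ⟩
    J + 2 * suc K ∸ 1
      ≡⟨ ≡.cong (λ n → J + 2 * n ∸ 1) (≡.sym (countB-remove (freeMachine m 𝓕) i₀-free)) ⟩
    MStar 𝓕 + 2 * kStar m 𝓕 ∸ 1 ∎
    where
    K J : ℕ
    K = countB (freeMachineExcept i₀)
    J = countB (freeJob 𝓕)
    count-identity : ∀ K J → J + 2 * suc K ≡ suc (suc K + (K + J))
    count-identity = solve-∀
    length-map-trues : ∀ {n} {A : Set} (f : Fin n → A) p → length (List.map f (trues p)) ≡ countB p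
    length-map-trues f p = ≡.trans (List.length-map f (trues p)) (length-trues p)

module SupportingGraph {c ℓ₁ ℓ₂} (𝔽 : OrderedField c ℓ₁ ℓ₂)
    {k M} (m : Fin k → ℕ) (t : Fin M → ℕ) (b : Fin k → OrderedField.Carrier 𝔽)
    (𝓕 : Fin k → Fin M → Bool) (x : BLPR.Sol 𝔽 k M)
    (E : List (Fin k × Fin M)) (edges : All (BLPR.Edge 𝔽 m 𝓕 x) E) where
  open OrderedField 𝔽
  open BLPR 𝔽
  open LinearAlgebra 𝔽
  open KroneckerDelta 𝔽
  open Perturbation 𝔽 t (List.lookup E)
  open ReducedSystem 𝔽 m 𝓕
  open import Relation.Binary.Reasoning.Setoid setoid

  edge : ∀ p → Edge m 𝓕 x (List.lookup E p)
  edge p = All.lookup edges (∈-lookup p)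

  machine-free : ∀ p → freeMachine m 𝓕 (machine p) ≡ true
  machine-free p = proj₁ (edge p)

  job-free : ∀ p → freeJob 𝓕 (job p) ≡ true
  job-free p = proj₁ (proj₂ (edge p))

  edge-nonzero : ∀ p → ¬ x (machine p) (job p) ≈ 0#
  edge-nonzero p x≈0 = proj₂ (proj₁ (proj₂ (proj₂ (edge p)))) (sym x≈0)

  edge-unfixed : ∀ p → 𝓕 (machine p) (job p) ≡ false
  edge-unfixed p = proj₂ (proj₂ (proj₂ (edge p)))

  module _ {i₀ : Fin k} {d : Fin (length E) → Carrier}
           (annihilates : Annihilates (List.map row (reduced i₀)) d) where

    reduced-annihilated : ∀ {C} → C ∈ reduced i₀ → ⟨ row C , d ⟩ ≈ 0#
    reduced-annihilated C∈reduced = All.lookup (All.map⁻ annihilates) C∈reduced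

    cap-annihilated : ∀ i → ⟨ row (cap i) , d ⟩ ≈ 0#
    cap-annihilated i with freeMachine m 𝓕 i in i-free
    ... | true  = reduced-annihilated (∈-++⁺ˡ (∈-map⁺ cap (∈-trues _ i-free)))
    ... | false = ⟨0, d ⟩ λ p →
      trans (*-congʳ (δ-≢ {a = i} {machine p} λ { ≡.refl → not-¬ i-free (machine-free p) })) (zeroˡ _)

    assign-annihilated : ∀ j → ⟨ row (assign j) , d ⟩ ≈ 0#
    assign-annihilated j with freeJob 𝓕 j in j-free
    ... | true  = reduced-annihilated
                    (∈-++⁺ʳ capRows (∈-++⁺ʳ (cardRowsExcept i₀) (∈-map⁺ assign (∈-trues _ j-free))))
    ... | false = ⟨0, d ⟩ λ p → δ-≢ {a = j} {job p} λ { ≡.refl → not-¬ j-free (job-free p) }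

    card-annihilated-≢ : ∀ i → i ≢ i₀ → ⟨ row (card i) , d ⟩ ≈ 0#
    card-annihilated-≢ i i≢i₀ with freeMachine m 𝓕 i in i-free
    ... | true  = reduced-annihilated (∈-++⁺ʳ capRows (∈-++⁺ˡ (∈-map⁺ card (∈-trues _ i-free′))))
      where
      i-free′ : freeMachineExcept i₀ i ≡ true
      i-free′ rewrite i-free with i ≟ i₀
      ... | yes i≡i₀ = ⊥-elim (i≢i₀ i≡i₀)
      ... | no _     = ≡.refl
    ... | false = ⟨0, d ⟩ λ p → δ-≢ {a = i} {machine p} λ { ≡.refl → not-¬ i-free (machine-free p) }

    -- each column of the card rows and of the assign rows contains a single 1, so the rows sum to the same form
    card-annihilated : ∀ i → ⟨ row (card i) , d ⟩ ≈ 0#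
    card-annihilated i with i ≟ i₀
    ... | no i≢i₀ = card-annihilated-≢ i i≢i₀
    ... | yes ≡.refl = begin
      ⟨ row (card i) , d ⟩                 ≈⟨ sum-single (λ i → ⟨ row (card i) , d ⟩) i card-annihilated-≢ ⟨
      sum (λ i → ⟨ row (card i) , d ⟩)     ≈⟨ sum-row-card d ⟩
      sum d                                ≈⟨ sum-row-assign d ⟨
      sum (λ j → ⟨ row (assign j) , d ⟩)   ≈⟨ sum-zero _ assign-annihilated ⟩
      0#                                   ∎

    tight-annihilated : ∀ C → Admissible 𝓕 C → Tight m t b x C → ⟨ row C , d ⟩ ≈ 0#
    tight-annihilated (cap i)      _     _     = cap-annihilated i
    tight-annihilated (card i)     _     _     = card-annihilated i
    tight-annihilated (assign j)   _     _     = assign-annihilated j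
    tight-annihilated (fix i j)    fixed _     = ⟨0, d ⟩ λ p →
      δδ-≢ {i = i} {machine p} {j} {job p} λ { ≡.refl → not-¬ (edge-unfixed p) fixed }
    tight-annihilated (nonneg i j) _     tight = ⟨0, d ⟩ λ p →
      δδ-≢ {i = i} {machine p} {j} {job p} λ { ≡.refl → edge-nonzero p (trans (sym (sum-δδ i j x)) tight) }

  -- x + spread d satisfies every tight constraint of x, so d vanishes by uniqueness of the basic solution.
  basic⇒trivialKernel : Unique E → Basic m t b 𝓕 x → ∀ i₀ → TrivialKernel (List.map row (reduced i₀))
  basic⇒trivialKernel unique (_ , S , admissible , _ , tight , uniqueSolution) i₀ d annihilates p = begin
    d p                            ≈⟨ spread-at (lookup-injective unique) d p ⟨
    spread d (machine p) (job p)   ≈⟨ x+y≈x⇒y≈0 _ _ (uniqueSolution (x +ˢ spread d) tight′ (machine p) (job p)) ⟩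
    0#                             ∎
    where
    tight′ : All (Tight m t b (x +ˢ spread d)) S
    tight′ = All.zipWith (λ { {C} (adm , tightC) →
                 tight-+spread {m} {b} {x} {C} d tightC (tight-annihilated annihilates C adm tightC) })
               (admissible , tight)

-- opened only now: the modules above use the field's _+_ and _*_
open import Data.Nat using (_+_; _*_; _∸_; _≤_; _<_)

corollary1 : ∀ {c ℓ₁ ℓ₂} (𝔽 : OrderedField c ℓ₁ ℓ₂) →
    let open BLPR 𝔽 in
    (k : ℕ) → 0 < k →
    (m : Fin k → ℕ) → (∀ i → 0 < m i) →
    (M : ℕ) → (t : Fin M → ℕ) → M ≤ sumℕ m →
    (b : Fin k → OrderedField.Carrier 𝔽) → (𝓕 : Fin k → Fin M → Bool) →
    (x : Sol k M) → Basic m t b 𝓕 x →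
    (E : List (Fin k × Fin M)) → Unique E → All (Edge m 𝓕 x) E →
    length E ≤ MStar 𝓕 + 2 * kStar m 𝓕 ∸ 1
corollary1 𝔽 _ _ m _ _ t _ b 𝓕 x basic [] _ _ = ℕ.z≤n
corollary1 𝔽 _ _ m _ _ t _ b 𝓕 x basic E@((i₀ , _) ∷ _) unique edges@(e₀ ∷ _) =
  ℕₚ.≮⇒≥ λ bound<|E| →
    length<⇒¬trivialKernel (List.map row (reduced i₀))
      (≡.subst (_< length E) (≡.sym length-rows) bound<|E|)
      (basic⇒trivialKernel unique basic i₀)
  where
  open LinearAlgebra 𝔽
  open Perturbation 𝔽 t (List.lookup E)
  open ReducedSystem 𝔽 m 𝓕
  open SupportingGraph 𝔽 m t b 𝓕 x E edges
  length-rows : length (List.map row (reduced i₀)) ≡ BLPR.MStar 𝔽 𝓕 + 2 * BLPR.kStar 𝔽 m 𝓕 ∸ 1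
  length-rows = ≡.trans (List.length-map row (reduced i₀)) (length-reduced (proj₁ e₀))
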